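{- Fix $m,p\in\mathbb{N}$ and let $a=(a_n)_{n\in\mathbb{N}_0}$, $b=(b_n)_{n\in\mathbb{N}_0}$ be given by $a_n=\lfloor n\phi_{mp}/p\rfloor$ and $b_n=\lfloor n(\phi_{mp}+mp)/p\rfloor$, where $\phi_k=\frac{2-k+\sqrt{k^2+4}}{2}$. Then: (i) $a=(a_n)_{n\in\mathbb{N}_0}$ and $(b_n)_{n\in\mathbb{N}}$ are $p$-complementary on $\mathbb{N}_0$; and for each $n\in\mathbb{N}_0$: (ii) $b_n-a_n=mn$; (iii) if $p=1$, then either $a_{n+1}-a_n=1$ and $b_{n+1}-b_n=m+1$, or $a_{n+1}-a_n=2$ and $b_{n+1}-b_n=m+2$; (iv) if $p>1$, then either $a_{n+1}-a_n=0$ and $b_{n+1}-b_n=m$, or $a_{n+1}-a_n=1$ and $b_{n+1}-b_n=m+1$.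
   Context: $\mathbb{N}=\{1,2,\dots\}$, $\mathbb{N}_0=\{0,1,2,\dots\}$. Two sequences $(x_i)_{i\in Q}$, $(y_i)_{i\in R}$ of non-negative integers are $p$-complementary on $\mathbb{N}_0$ if for each $n\in\mathbb{N}_0$, $\#\{i\in Q:x_i=n\}+\#\{i\in R:y_i=n\}=p$. -}

module Defs where

open import Data.Nat using (ℕ; zero; suc; _+_; _*_)
open import Data.Integer as ℤ using (ℤ; +_; ∣_∣)
open import Data.List using (List; length)
open import Data.List.Relation.Unary.All using (All)
open import Data.List.Relation.Unary.Unique.Propositional using (Unique)
open import Data.List.Membership.Propositional using (_∈_)
open import Data.Product using (Σ; _×_)
open import Data.Sum using (_⊎_)
open import Relation.Nullary using (¬_)
open import Relation.Binary.PropositionalEquality using (_≡_)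

-- A real number of the form (num + coef * √rad) / den, with den > 0
-- (the denominators used below are always positive).
record Surd : Set where
  constructor surd
  field
    num  : ℤ
    coef : ℕ
    rad  : ℕ
    den  : ℕ
open Surd public

-- q ≤ (u + v √d) / w   ⟺   q w - u ≤ v √d   (w > 0, v ≥ 0)
-- ⟺ (q w - u ≤ 0) or (q w - u)² ≤ v² d.
_≤ˢ_ : ℤ → Surd → Set
q ≤ˢ x = (t ℤ.≤ ℤ.0ℤ) ⊎ (∣ t ∣ * ∣ t ∣ Data.Nat.≤ coef x * coef x * rad x)
  where
  t = q ℤ.* + den x ℤ.- num x

IsFloor : Surd → ℕ → Set
IsFloor x q = ((+ q) ≤ˢ x) × ¬ ((+ suc q) ≤ˢ x)

-- φ_k = (2 - k + √(k² + 4)) / 2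
φ : ℕ → Surd
φ k = surd (+ 2 ℤ.- + k) 1 (k * k + 4) 2

addℕ : Surd → ℕ → Surd
addℕ (surd u v d w) k = surd (u ℤ.+ + (k * w)) v d w

mulDiv : ℕ → Surd → ℕ → Surd
mulDiv n (surd u v d w) p = surd (+ n ℤ.* u) (n * v) d (p * w)

HasCount : (ℕ → ℕ) → ℕ → ℕ → Set
HasCount x n c = Σ (List ℕ) λ L →
  Unique L × All (λ i → x i ≡ n) L × (∀ i → x i ≡ n → i ∈ L) × length L ≡ c

Complementary : ℕ → (ℕ → ℕ) → (ℕ → ℕ) → Set
Complementary p x y = ∀ n → Σ ℕ λ c₁ → Σ ℕ λ c₂ →
  HasCount x n c₁ × HasCount y n c₂ × c₁ + c₂ ≡ p

module Submission where

-- The module Quadratic then studies  N ≤ iφ  and  N ≤ iψ: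
-- they are superadditive in (N, i) (which bounds the increments), φ is
-- irrational (by descent), and 1/φ + 1/ψ = 1 appears as `reflect`:
-- N > iψ ⟺ N ≤ (N − i)φ.  Hence Beatty's count
-- #{i ≤ pJ | a i < J} + #{i ≤ pJ | b i < J} = pJ + 1, and complementarity
-- is the difference of such counts at J = j and J = j + 1.  The module
-- Sequences derives the four parts, and lemma3p3 collects them.

open import Defs
open import Data.Nat
  using (ℕ; zero; suc; _+_; _*_; _∸_; _≤_; _<_; _>_; z≤n; s≤s; _≤?_; _<?_; _≟_)
import Data.Nat.Properties as ℕP
open import Algebra.Properties.CommutativeSemigroup ℕP.+-commutativeSemigroup using (interchange; x∙yz≈y∙xz)
open import Data.Nat.Induction using (<-wellFounded)
import Data.Nat.Tactic.RingSolver as ℕR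
open import Data.Integer as ℤ using (ℤ; +_; -[1+_]; ∣_∣)
import Data.Integer.Properties as ℤP
import Data.Integer.Tactic.RingSolver as ℤR
open import Data.Product using (_×_; _,_; proj₁; proj₂)
open import Data.Sum as Sum using (_⊎_; inj₁; inj₂; [_,_]′)
open import Data.Empty using (⊥-elim)
open import Data.List using (List; []; _∷_; length)
open import Data.List.Relation.Unary.All as All using (All; []; _∷_)
open import Data.List.Relation.Unary.AllPairs using ([]; _∷_)
open import Data.List.Relation.Unary.Unique.Propositional using (Unique)
open import Data.List.Relation.Unary.Any using (here; there)
open import Data.List.Membership.Propositional using (_∈_)
open import Induction.WellFounded using (Acc; acc)
open import Function.Bundles using (_⇔_; mk⇔; Equivalence)
open import Function.Construct.Composition using (_⇔-∘_)
open import Function.Construct.Identity using (⇔-id)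
open import Relation.Nullary using (¬_; Dec; yes; no; ¬?; _⊎-dec_)
open import Relation.Unary using (Decidable)
open import Relation.Binary.PropositionalEquality

open Equivalence using (to; from)

-- T ≤√ c  says  T ≤ √c.  By definition of _≤ˢ_, the proposition
-- q ≤ˢ x  is literally  (q · den x − num x) ≤√ (coef x² · rad x).
infix 4 _≤√_ _≤√?_

_≤√_ : ℤ → ℕ → Set
T ≤√ c = (T ℤ.≤ ℤ.0ℤ) ⊎ (∣ T ∣ * ∣ T ∣ ≤ c)

_≤√?_ : ∀ T c → Dec (T ≤√ c)
T ≤√? c = (T ℤ.≤? ℤ.0ℤ) ⊎-dec (∣ T ∣ * ∣ T ∣ ≤? c)

≤√-mono : ∀ {T' T c c'} → T' ℤ.≤ T → c ≤ c' → T ≤√ c → T' ≤√ c'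
≤√-mono T'≤T c≤c' (inj₁ T≤0) = inj₁ (ℤP.≤-trans T'≤T T≤0)
≤√-mono { -[1+ _ ]} T'≤T c≤c' (inj₂ _) = inj₁ ℤ.-≤+
≤√-mono {+ _} {+ _} (ℤ.+≤+ t'≤t) c≤c' (inj₂ sq) =
  inj₂ (ℕP.≤-trans (ℕP.*-mono-≤ t'≤t t'≤t) (ℕP.≤-trans sq c≤c'))

sq-≤⇒≤ : ∀ {x y} → x * x ≤ y * y → x ≤ y
sq-≤⇒≤ {x} {y} h with x ≤? y
... | yes x≤y = x≤y
... | no x≰y = ⊥-elim (ℕP.<⇒≱ (ℕP.*-mono-< y<x y<x) h)
  where y<x = ℕP.≰⇒> x≰y

square-+ : ∀ a b → (a + b) * (a + b) ≡ a * a + b * b + 2 * (a * b)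
square-+ = ℕR.solve-∀

square-+-√ : ∀ v w D → (v + w) * (v + w) * D ≡ v * v * D + w * w * D + 2 * (v * w * D)
square-+-√ = ℕR.solve-∀

square-* : ∀ a b → (a * b) * (a * b) ≡ (a * a) * (b * b)
square-* = ℕR.solve-∀

square-*-√ : ∀ v w D → (v * w * D) * (v * w * D) ≡ (v * v * D) * (w * w * D)
square-*-√ = ℕR.solve-∀

-- Squared form of  a ≤ v√D, b ≤ w√D ⇒ a + b ≤ (v + w)√D; the cross term
-- ab is compared with vwD through its square.
sq-+-≤ : ∀ a b v w D → a * a ≤ v * v * D → b * b ≤ w * w * D →
         (a + b) * (a + b) ≤ (v + w) * (v + w) * D
sq-+-≤ a b v w D a≤ b≤ = begin
  (a + b) * (a + b)                       ≡⟨ square-+ a b ⟩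
  a * a + b * b + 2 * (a * b)             ≤⟨ ℕP.+-mono-≤ (ℕP.+-mono-≤ a≤ b≤) (ℕP.*-monoʳ-≤ 2 ab≤) ⟩
  v * v * D + w * w * D + 2 * (v * w * D) ≡⟨ square-+-√ v w D ⟨
  (v + w) * (v + w) * D                   ∎
  where
  open ℕP.≤-Reasoning
  ab≤ : a * b ≤ v * w * D
  ab≤ = sq-≤⇒≤ (subst₂ _≤_ (sym (square-* a b)) (sym (square-*-√ v w D)) (ℕP.*-mono-≤ a≤ b≤))

sq-+-< : ∀ a b v w D → v * v * D < a * a → w * w * D < b * b →
         (v + w) * (v + w) * D < (a + b) * (a + b)
sq-+-< a b v w D <a <b = begin-strict
  (v + w) * (v + w) * D                   ≡⟨ square-+-√ v w D ⟩
  v * v * D + w * w * D + 2 * (v * w * D) <⟨ ℕP.+-mono-<-≤ (ℕP.+-mono-< <a <b) (ℕP.*-monoʳ-≤ 2 (ℕP.<⇒≤ <ab)) ⟩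
  a * a + b * b + 2 * (a * b)             ≡⟨ square-+ a b ⟨
  (a + b) * (a + b)                       ∎
  where
  open ℕP.≤-Reasoning
  <ab : v * w * D < a * b
  <ab = ℕP.≰⇒> λ ab≤ → ℕP.<⇒≱
    (subst₂ _<_ (sym (square-*-√ v w D)) (sym (square-* a b)) (ℕP.*-mono-< <a <b))
    (ℕP.*-mono-≤ ab≤ ab≤)

+-nonPos-≤ˡ : ∀ {T} T' → T ℤ.≤ ℤ.0ℤ → T ℤ.+ T' ℤ.≤ T'
+-nonPos-≤ˡ {T} T' T≤0 = subst (T ℤ.+ T' ℤ.≤_) (ℤP.+-identityˡ T') (ℤP.+-monoˡ-≤ T' T≤0)

+-nonPos-≤ʳ : ∀ T {T'} → T' ℤ.≤ ℤ.0ℤ → T ℤ.+ T' ℤ.≤ T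
+-nonPos-≤ʳ T {T'} T'≤0 = subst (T ℤ.+ T' ℤ.≤_) (ℤP.+-identityʳ T) (ℤP.+-monoʳ-≤ T T'≤0)

√-≤ˡ : ∀ v w D → v * v * D ≤ (v + w) * (v + w) * D
√-≤ˡ v w D = ℕP.*-monoˡ-≤ D (ℕP.*-mono-≤ (ℕP.m≤m+n v w) (ℕP.m≤m+n v w))

√-≤ʳ : ∀ v w D → w * w * D ≤ (v + w) * (v + w) * D
√-≤ʳ v w D = ℕP.*-monoˡ-≤ D (ℕP.*-mono-≤ (ℕP.m≤n+m w v) (ℕP.m≤n+m w v))

≤√-+ : ∀ {T T' v w D} → T ≤√ (v * v * D) → T' ≤√ (w * w * D) →
       (T ℤ.+ T') ≤√ ((v + w) * (v + w) * D)
≤√-+ {T} {T'} {v} {w} {D} (inj₁ T≤0) h' = ≤√-mono (+-nonPos-≤ˡ T' T≤0) (√-≤ʳ v w D) h'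
≤√-+ {T} {T'} {v} {w} {D} h (inj₁ T'≤0) = ≤√-mono (+-nonPos-≤ʳ T T'≤0) (√-≤ˡ v w D) h
≤√-+ { -[1+ _ ]} {T'} {v} {w} {D} (inj₂ _) h' =
  ≤√-mono (+-nonPos-≤ˡ T' ℤ.-≤+) (√-≤ʳ v w D) h'
≤√-+ {+ t} { -[1+ _ ]} {v} {w} {D} h (inj₂ _) =
  ≤√-mono (+-nonPos-≤ʳ (+ t) ℤ.-≤+) (√-≤ˡ v w D) h
≤√-+ {+ t} {+ t'} {v} {w} {D} (inj₂ sq) (inj₂ sq') = inj₂ (sq-+-≤ t t' v w D sq sq')

≰√-+ : ∀ {T T' v w D} → ¬ T ≤√ (v * v * D) → ¬ T' ≤√ (w * w * D) →
       ¬ (T ℤ.+ T') ≤√ ((v + w) * (v + w) * D)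
≰√-+ { -[1+ _ ]} ¬h ¬h' = ⊥-elim (¬h (inj₁ ℤ.-≤+))
≰√-+ {+ _} { -[1+ _ ]} ¬h ¬h' = ⊥-elim (¬h' (inj₁ ℤ.-≤+))
≰√-+ {+ t} {+ t'} ¬h ¬h' (inj₁ (ℤ.+≤+ t+t'≤0)) =
  ¬h (inj₁ (ℤ.+≤+ (ℕP.≤-trans (ℕP.m≤m+n t t') t+t'≤0)))
≰√-+ {+ t} {+ t'} {v} {w} {D} ¬h ¬h' (inj₂ sq) =
  ℕP.<⇒≱ (sq-+-< t t' v w D (ℕP.≰⇒> (λ h → ¬h (inj₂ h))) (ℕP.≰⇒> (λ h → ¬h' (inj₂ h)))) sq

square-diff : ∀ {X Y} → Y ≤ X → (X ∸ Y) * (X ∸ Y) + 2 * (X * Y) ≡ X * X + Y * Y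
square-diff {X} {Y} Y≤X = begin
  d * d + 2 * (X * Y)             ≡⟨ cong (λ z → d * d + 2 * (z * Y)) X≡ ⟨
  d * d + 2 * ((d + Y) * Y)       ≡⟨ expand d Y ⟩
  (d + Y) * (d + Y) + Y * Y       ≡⟨ cong (λ z → z * z + Y * Y) X≡ ⟩
  X * X + Y * Y                   ∎
  where
  open ≡-Reasoning
  d = X ∸ Y
  X≡ : d + Y ≡ X
  X≡ = ℕP.m∸n+n≡m Y≤X
  expand : ∀ d Y → d * d + 2 * ((d + Y) * Y) ≡ (d + Y) * (d + Y) + Y * Y
  expand = ℕR.solve-∀

-- For naturals X and Y:  X − Y ≤ √c  ⟺  X ≤ Y  or  X² + Y² ≤ c + 2XY.
-- This turns every comparison with a square root into one between naturals.
diff-≤√ : ∀ X Y c → (+ X ℤ.- + Y) ≤√ c ⇔ (X ≤ Y ⊎ X * X + Y * Y ≤ c + 2 * (X * Y))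
diff-≤√ X Y c = mk⇔ ⇒ ⇐
  where
  ∣X-Y∣ : Y ≤ X → ∣ + X ℤ.- + Y ∣ ≡ X ∸ Y
  ∣X-Y∣ Y≤X = cong ∣_∣ (trans (ℤP.m-n≡m⊖n X Y) (ℤP.⊖-≥ Y≤X))
  squared : Y ≤ X → (X ∸ Y) * (X ∸ Y) ≤ c ⇔ X * X + Y * Y ≤ c + 2 * (X * Y)
  squared Y≤X = mk⇔
    (λ h → subst (_≤ c + 2 * (X * Y)) (square-diff Y≤X) (ℕP.+-monoˡ-≤ (2 * (X * Y)) h))
    (λ h → ℕP.+-cancelʳ-≤ (2 * (X * Y)) _ _ (subst (_≤ c + 2 * (X * Y)) (sym (square-diff Y≤X)) h))
  ⇒ : (+ X ℤ.- + Y) ≤√ c → X ≤ Y ⊎ X * X + Y * Y ≤ c + 2 * (X * Y)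
  ⇒ (inj₁ X-Y≤0) = inj₁ (ℤP.drop‿+≤+ (ℤP.i-j≤0⇒i≤j X-Y≤0))
  ⇒ (inj₂ sq) with X ≤? Y
  ... | yes X≤Y = inj₁ X≤Y
  ... | no X≰Y = inj₂ (to (squared Y≤X) (subst (λ z → z * z ≤ c) (∣X-Y∣ Y≤X) sq))
    where Y≤X = ℕP.<⇒≤ (ℕP.≰⇒> X≰Y)
  ⇐ : X ≤ Y ⊎ X * X + Y * Y ≤ c + 2 * (X * Y) → (+ X ℤ.- + Y) ≤√ c
  ⇐ (inj₁ X≤Y) = inj₁ (ℤP.i≤j⇒i-j≤0 (ℤ.+≤+ X≤Y))
  ⇐ (inj₂ h) with X ≤? Y
  ... | yes X≤Y = inj₁ (ℤP.i≤j⇒i-j≤0 (ℤ.+≤+ X≤Y))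
  ... | no X≰Y = inj₂ (subst (λ z → z * z ≤ c) (sym (∣X-Y∣ Y≤X)) (from (squared Y≤X) h))
    where Y≤X = ℕP.<⇒≤ (ℕP.≰⇒> X≰Y)

diff-+ : ∀ X Y X' Y' → + (X + X') ℤ.- + (Y + Y') ≡ (+ X ℤ.- + Y) ℤ.+ (+ X' ℤ.- + Y')
diff-+ X Y X' Y' = begin
  + (X + X') ℤ.- + (Y + Y')             ≡⟨ cong₂ ℤ._-_ (ℤP.pos-+ X X') (ℤP.pos-+ Y Y') ⟩
  (+ X ℤ.+ + X') ℤ.- (+ Y ℤ.+ + Y')     ≡⟨ regroup (+ X) (+ Y) (+ X') (+ Y') ⟩
  (+ X ℤ.- + Y) ℤ.+ (+ X' ℤ.- + Y')     ∎
  where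
  open ≡-Reasoning
  regroup : ∀ a b a' b' → (a ℤ.+ a') ℤ.- (b ℤ.+ b') ≡ (a ℤ.- b) ℤ.+ (a' ℤ.- b')
  regroup = ℤR.solve-∀

diff-cong : ∀ {X Y X' Y'} → X + Y' ≡ X' + Y → + X ℤ.- + Y ≡ + X' ℤ.- + Y'
diff-cong {X} {Y} {X'} {Y'} cross = begin
  + X ℤ.- + Y                           ≡⟨ shift (+ X) (+ Y) (+ Y') ⟩
  (+ X ℤ.+ + Y') ℤ.- (+ Y ℤ.+ + Y')     ≡⟨ cong (ℤ._- (+ Y ℤ.+ + Y')) (ℤP.pos-+ X Y') ⟨
  + (X + Y') ℤ.- (+ Y ℤ.+ + Y')         ≡⟨ cong (λ z → + z ℤ.- (+ Y ℤ.+ + Y')) cross ⟩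
  + (X' + Y) ℤ.- (+ Y ℤ.+ + Y')         ≡⟨ cong (ℤ._- (+ Y ℤ.+ + Y')) (ℤP.pos-+ X' Y) ⟩
  (+ X' ℤ.+ + Y) ℤ.- (+ Y ℤ.+ + Y')     ≡⟨ unshift (+ X') (+ Y) (+ Y') ⟩
  + X' ℤ.- + Y'                         ∎
  where
  open ≡-Reasoning
  shift : ∀ a b c → a ℤ.- b ≡ (a ℤ.+ c) ℤ.- (b ℤ.+ c)
  shift = ℤR.solve-∀
  unshift : ∀ a b c → (a ℤ.+ b) ℤ.- (b ℤ.+ c) ≡ a ℤ.- c
  unshift = ℤR.solve-∀

≤ˢ-downward : ∀ x {J' J} → J' ≤ J → (+ J) ≤ˢ x → (+ J') ≤ˢ x
≤ˢ-downward x J'≤J = ≤√-mono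
  (ℤP.+-monoˡ-≤ (ℤ.- num x) (ℤP.*-monoʳ-≤-nonNeg (+ den x) (ℤ.+≤+ J'≤J))) ℕP.≤-refl

floor-<⇔ : ∀ x {q J} → IsFloor x q → q < J ⇔ (¬ (+ J) ≤ˢ x)
floor-<⇔ x (q≤x , q+1≰x) = mk⇔
  (λ q<J J≤x → q+1≰x (≤ˢ-downward x q<J J≤x))
  (λ J≰x → ℕP.≰⇒> (λ J≤q → J≰x (≤ˢ-downward x J≤q q≤x)))

floor-unique : ∀ x {q q'} → IsFloor x q → IsFloor x q' → q ≡ q'
floor-unique x f f' = ℕP.≤-antisym (below f' f) (below f f')
  where
  below : ∀ {q q'} → IsFloor x q → IsFloor x q' → q' ≤ q
  below f f' = ℕP.≮⇒≥ (λ q<q' → to (floor-<⇔ x f) q<q' (proj₁ f'))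

ind : ∀ {A : Set} → Dec A → ℕ
ind (yes _) = 1
ind (no _) = 0

count : ∀ {P : ℕ → Set} → Decidable P → ℕ → ℕ
count P? zero = 0
count P? (suc n) = ind (P? n) + count P? n

witnesses : ∀ {P : ℕ → Set} → Decidable P → ℕ → List ℕ
witnesses P? zero = []
witnesses P? (suc n) with P? n
... | yes _ = n ∷ witnesses P? n
... | no _ = witnesses P? n

module _ {P : ℕ → Set} (P? : Decidable P) where

  length-witnesses : ∀ n → length (witnesses P? n) ≡ count P? n
  length-witnesses zero = refl
  length-witnesses (suc n) with P? n
  ... | yes _ = cong suc (length-witnesses n)
  ... | no _ = length-witnesses n

  witnesses-< : ∀ n → All (_< n) (witnesses P? n)
  witnesses-< zero = []
  witnesses-< (suc n) with P? n
  ... | yes _ = ℕP.≤-refl ∷ All.map ℕP.m<n⇒m<1+n (witnesses-< n)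
  ... | no _ = All.map ℕP.m<n⇒m<1+n (witnesses-< n)

  witnesses-sound : ∀ n → All P (witnesses P? n)
  witnesses-sound zero = []
  witnesses-sound (suc n) with P? n
  ... | yes Pn = Pn ∷ witnesses-sound n
  ... | no _ = witnesses-sound n

  witnesses-unique : ∀ n → Unique (witnesses P? n)
  witnesses-unique zero = []
  witnesses-unique (suc n) with P? n
  ... | yes _ = All.map (λ i<n n≡i → ℕP.<-irrefl (sym n≡i) i<n) (witnesses-< n) ∷ witnesses-unique n
  ... | no _ = witnesses-unique n

  witnesses-complete : ∀ n i → i < n → P i → i ∈ witnesses P? n
  witnesses-complete (suc n) i i<1+n Pi with P? n | ℕP.m≤n⇒m<n∨m≡n (ℕP.≤-pred i<1+n)
  ... | yes _ | inj₁ i<n = there (witnesses-complete n i i<n Pi)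
  ... | yes _ | inj₂ refl = here refl
  ... | no _ | inj₁ i<n = witnesses-complete n i i<n Pi
  ... | no ¬Pn | inj₂ refl = ⊥-elim (¬Pn Pi)

count-HasCount : ∀ (x : ℕ → ℕ) j n → (∀ i → x i ≡ j → i < n) →
                 HasCount x j (count (λ i → x i ≟ j) n)
count-HasCount x j n bounded =
    witnesses P? n , witnesses-unique P? n , witnesses-sound P? n
  , (λ i xi≡j → witnesses-complete P? n i (bounded i xi≡j) xi≡j) , length-witnesses P? n
  where P? = λ i → x i ≟ j

ind-cong : ∀ {A B : Set} (A? : Dec A) (B? : Dec B) → A ⇔ B → ind A? ≡ ind B?
ind-cong (yes _) (yes _) _ = refl
ind-cong (no _) (no _) _ = refl
ind-cong (yes a) (no ¬b) A⇔B = ⊥-elim (¬b (to A⇔B a))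
ind-cong (no ¬a) (yes b) A⇔B = ⊥-elim (¬a (from A⇔B b))

count-cong : ∀ {P Q : ℕ → Set} (P? : Decidable P) (Q? : Decidable Q) n →
             (∀ i → i < n → P i ⇔ Q i) → count P? n ≡ count Q? n
count-cong P? Q? zero _ = refl
count-cong P? Q? (suc n) P⇔Q = cong₂ _+_ (ind-cong (P? n) (Q? n) (P⇔Q n ℕP.≤-refl))
  (count-cong P? Q? n (λ i i<n → P⇔Q i (ℕP.m<n⇒m<1+n i<n)))

count-complement : ∀ {P : ℕ → Set} (P? : Decidable P) n → count P? n + count (λ i → ¬? (P? i)) n ≡ n
count-complement P? zero = refl
count-complement P? (suc n) with P? n
... | yes _ = cong suc (count-complement P? n)
... | no _ = trans (ℕP.+-suc (count P? n) _) (cong suc (count-complement P? n))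

count-⊎ : ∀ {R P Q : ℕ → Set} (R? : Decidable R) (P? : Decidable P) (Q? : Decidable Q) n →
          (∀ i → R i ⇔ (P i ⊎ Q i)) → (∀ i → P i → ¬ Q i) → count R? n ≡ count P? n + count Q? n
count-⊎ R? P? Q? zero _ _ = refl
count-⊎ {R} {P} {Q} R? P? Q? (suc n) R⇔P⊎Q disjoint = begin
  ind (R? n) + count R? n                                 ≡⟨ cong₂ _+_ (ind-⊎ (R? n) (P? n) (Q? n)) (count-⊎ R? P? Q? n R⇔P⊎Q disjoint) ⟩
  (ind (P? n) + ind (Q? n)) + (count P? n + count Q? n)   ≡⟨ interchange (ind (P? n)) (ind (Q? n)) (count P? n) (count Q? n) ⟩
  (ind (P? n) + count P? n) + (ind (Q? n) + count Q? n)   ∎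
  where
  open ≡-Reasoning
  ind-⊎ : (r? : Dec (R n)) (p? : Dec (P n)) (q? : Dec (Q n)) → ind r? ≡ ind p? + ind q?
  ind-⊎ r? (yes p) (yes q) = ⊥-elim (disjoint n p q)
  ind-⊎ r? (yes p) (no _) = ind-cong r? (yes p) (mk⇔ (λ _ → p) (λ p → from (R⇔P⊎Q n) (inj₁ p)))
  ind-⊎ r? (no _) (yes q) = ind-cong r? (yes q) (mk⇔ (λ _ → q) (λ q → from (R⇔P⊎Q n) (inj₂ q)))
  ind-⊎ r? (no ¬p) (no ¬q) = ind-cong r? (no ¬p) (mk⇔ neither (λ p → ⊥-elim (¬p p)))
    where
    neither : R n → P n
    neither r with to (R⇔P⊎Q n) r
    ... | inj₁ p = p
    ... | inj₂ q = ⊥-elim (¬q q)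

count-stable : ∀ {P : ℕ → Set} (P? : Decidable P) {n M} → n ≤ M → (∀ i → P i → i < n) →
               count P? M ≡ count P? n
count-stable P? {n} {M} n≤M bounded =
  trans (cong (count P?) (sym (ℕP.m∸n+n≡m n≤M))) (beyond (M ∸ n))
  where
  beyond : ∀ d → count P? (d + n) ≡ count P? n
  beyond zero = refl
  beyond (suc d) with P? (d + n)
  ... | yes P[d+n] = ⊥-elim (ℕP.<⇒≱ (bounded _ P[d+n]) (ℕP.m≤n+m n d))
  ... | no _ = beyond d

count-suc : ∀ {P : ℕ → Set} (P? : Decidable P) n →
            count P? (suc n) ≡ ind (P? 0) + count (λ i → P? (suc i)) n
count-suc P? zero = refl
count-suc P? (suc n) = begin
  ind (P? (suc n)) + count P? (suc n)                        ≡⟨ cong (_+_ (ind (P? (suc n)))) (count-suc P? n) ⟩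
  ind (P? (suc n)) + (ind (P? 0) + count (λ i → P? (suc i)) n) ≡⟨ x∙yz≈y∙xz (ind (P? (suc n))) (ind (P? 0)) (count (λ i → P? (suc i)) n) ⟩
  ind (P? 0) + (ind (P? (suc n)) + count (λ i → P? (suc i)) n) ∎
  where open ≡-Reasoning

count-reflect : ∀ {P : ℕ → Set} (P? : Decidable P) n →
                count (λ i → P? (n ∸ i)) (suc n) ≡ count P? (suc n)
count-reflect P? zero = refl
count-reflect {P} P? (suc n) = begin
  ind (P? (n ∸ n)) + count (λ i → P? (suc n ∸ i)) (suc n)
    ≡⟨ cong₂ _+_ (ind-cong (P? (n ∸ n)) (P? 0) (≡⇔ (ℕP.n∸n≡0 n)))
                 (count-cong (λ i → P? (suc n ∸ i)) (λ i → P? (suc (n ∸ i))) (suc n)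
                   (λ i i<1+n → ≡⇔ (ℕP.+-∸-assoc 1 (ℕP.≤-pred i<1+n)))) ⟩
  ind (P? 0) + count (λ i → P? (suc (n ∸ i))) (suc n)
    ≡⟨ cong (_+_ (ind (P? 0))) (count-reflect (λ i → P? (suc i)) n) ⟩
  ind (P? 0) + count (λ i → P? (suc i)) (suc n)
    ≡⟨ count-suc P? (suc n) ⟨
  count P? (suc (suc n)) ∎
  where
  open ≡-Reasoning
  ≡⇔ : ∀ {i j} → i ≡ j → P i ⇔ P j
  ≡⇔ refl = mk⇔ (λ x → x) (λ x → x)

count-<-suc : ∀ (f : ℕ → ℕ) j n →
              count (λ i → f i <? suc j) n ≡ count (λ i → f i <? j) n + count (λ i → f i ≟ j) n
count-<-suc f j n = count-⊎ (λ i → f i <? suc j) (λ i → f i <? j) (λ i → f i ≟ j) n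
  (λ i → mk⇔ (λ fi<1+j → ℕP.m≤n⇒m<n∨m≡n (ℕP.≤-pred fi<1+j))
             [ ℕP.m<n⇒m<1+n , (λ fi≡j → ℕP.≤-reflexive (cong suc fi≡j)) ]′)
  (λ i fi<j fi≡j → ℕP.<-irrefl fi≡j fi<j)

balance : ∀ {a b l h} → a + 4 * h ≡ b + 4 * l → a ≤ b ⇔ l ≤ h
balance {a} {b} {l} {h} eq = mk⇔
  (λ a≤b → ℕP.*-cancelˡ-≤ 4 (ℕP.+-cancelˡ-≤ b _ _
    (subst (_≤ b + 4 * h) eq (ℕP.+-monoˡ-≤ (4 * h) a≤b))))
  (λ l≤h → ℕP.+-cancelʳ-≤ (4 * h) a b
    (subst (_≤ b + 4 * h) (sym eq) (ℕP.+-monoʳ-≤ b (ℕP.*-monoʳ-≤ 4 l≤h))))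

cross-< : ∀ {a b c d} → a + b ≡ c + d → b < d → c < a
cross-< {a} {b} {c} {d} eq b<d =
  ℕP.+-cancelʳ-< d c a (subst (_< a + d) eq (ℕP.+-monoʳ-< a b<d))

two-values : ∀ {c x} → c ≤ x → x < 2 + c → x ≡ c ⊎ x ≡ suc c
two-values {c} c≤x x<2+c with ℕP.m≤n⇒∃[o]m+o≡n c≤x
... | zero , refl = inj₁ (ℕP.+-identityʳ c)
... | suc zero , refl = inj₂ (ℕP.+-comm c 1)
... | suc (suc o) , refl =
  ⊥-elim (ℕP.<⇒≱ x<2+c (subst (2 + c ≤_) (ℕP.+-comm (2 + o) c) (ℕP.+-monoˡ-≤ c (ℕP.m≤m+n 2 o))))

increment-p≡1 : ∀ {a a'} → 1 + 1 * a < 1 * suc a' → 1 * a' < 2 + 1 * suc a →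
                a' ≡ a + 1 ⊎ a' ≡ a + 2
increment-p≡1 {a} {a'} lo hi =
  Sum.map (λ e → trans e (ℕP.+-comm 1 a)) (λ e → trans e (ℕP.+-comm 2 a))
    (two-values (ℕP.≤-pred lo′) hi′)
  where
  lo′ : 1 + a < suc a'
  lo′ = subst₂ (λ u v → 1 + u < v) (ℕP.*-identityˡ a) (ℕP.*-identityˡ (suc a')) lo
  hi′ : a' < 2 + suc a
  hi′ = subst₂ (λ u v → u < 2 + v) (ℕP.*-identityˡ a') (ℕP.*-identityˡ (suc a)) hi

increment-p>1 : ∀ {p a a'} → p > 1 → 1 + p * a < p * suc a' → p * a' < 2 + p * suc a →
                a' ≡ a ⊎ a' ≡ a + 1
increment-p>1 {p} {a} {a'} p>1 lo hi =
  Sum.map₂ (λ e → trans e (ℕP.+-comm 1 a)) (two-values a≤a' a'<2+a)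
  where
  a≤a' : a ≤ a'
  a≤a' = ℕP.≤-pred (ℕP.*-cancelˡ-< p a (suc a') (ℕP.<-trans (ℕP.n<1+n (p * a)) lo))
  bound : 2 + p * suc a ≤ p * (2 + a)
  bound = subst (2 + p * suc a ≤_) (sym (ℕP.*-suc p (suc a))) (ℕP.+-monoˡ-≤ (p * suc a) p>1)
  a'<2+a : a' < 2 + a
  a'<2+a = ℕP.*-cancelˡ-< p a' (2 + a) (ℕP.<-≤-trans hi bound)

-- φ is the positive root of t² + (k − 2)t − k, ψ the larger root of
-- t² − (k + 2)t + k, and 1/φ + 1/ψ = 1.  Comparisons  N ≤ iφ  and  N ≤ iψ
-- are expressed exactly, via _≤√_, and then as polynomial inequalities.
module Quadratic (k : ℕ) (k≥1 : 1 ≤ k) where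

  D : ℕ
  D = k * k + 4

  -- N ≤ iφ  ⟺  2N + ki − 2i ≤ i√D.
  Tφ : ℕ → ℕ → ℤ
  Tφ N i = + (2 * N + k * i) ℤ.- + (2 * i)

  infix 4 _≤φ_ _≤ψ_ _≤φ?_

  _≤φ_ : ℕ → ℕ → Set
  N ≤φ i = Tφ N i ≤√ (i * i * D)

  -- N ≤ iψ  ⟺  2N − (2 + k)i ≤ i√D.
  _≤ψ_ : ℕ → ℕ → Set
  N ≤ψ i = (+ (2 * N) ℤ.- + ((2 + k) * i)) ≤√ (i * i * D)

  _≤φ?_ : ∀ N i → Dec (N ≤φ i)
  N ≤φ? i = Tφ N i ≤√? (i * i * D)

  -- iψ = iφ + ki.
  ≤ψ-shift : ∀ N i → ((N + k * i) ≤ψ i) ≡ (N ≤φ i)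
  ≤ψ-shift N i = cong (_≤√ (i * i * D))
    (diff-cong {2 * (N + k * i)} {(2 + k) * i} {2 * N + k * i} {2 * i} (cross k N i))
    where
    cross : ∀ k N i → 2 * (N + k * i) + 2 * i ≡ (2 * N + k * i) + (2 + k) * i
    cross = ℕR.solve-∀

  ≤φ-downward : ∀ {N' N i} → N' ≤ N → N ≤φ i → N' ≤φ i
  ≤φ-downward {i = i} N'≤N = ≤√-mono
    (ℤP.+-monoˡ-≤ (ℤ.- + (2 * i)) (ℤ.+≤+ (ℕP.+-monoˡ-≤ (k * i) (ℕP.*-monoʳ-≤ 2 N'≤N))))
    ℕP.≤-refl

  Tφ-+ : ∀ N N' i j → Tφ (N + N') (i + j) ≡ Tφ N i ℤ.+ Tφ N' j
  Tφ-+ N N' i j =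
    trans (cong₂ (λ X Y → + X ℤ.- + Y) (expand k N N' i j) (ℕP.*-distribˡ-+ 2 i j))
          (diff-+ (2 * N + k * i) (2 * i) (2 * N' + k * j) (2 * j))
    where
    expand : ∀ k N N' i j → 2 * (N + N') + k * (i + j) ≡ (2 * N + k * i) + (2 * N' + k * j)
    expand = ℕR.solve-∀

  ≤φ-+ : ∀ {N N' i j} → N ≤φ i → N' ≤φ j → (N + N') ≤φ (i + j)
  ≤φ-+ {N} {N'} {i} {j} h h' = subst (_≤√ _) (sym (Tφ-+ N N' i j)) (≤√-+ {v = i} {w = j} {D = D} h h')

  ≰φ-+ : ∀ {N N' i j} → ¬ N ≤φ i → ¬ N' ≤φ j → ¬ (N + N') ≤φ (i + j)
  ≰φ-+ {N} {N'} {i} {j} ¬h ¬h' h = ≰√-+ {v = i} {w = j} {D = D} ¬h ¬h' (subst (_≤√ _) (Tφ-+ N N' i j) h)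

  1≤φ : 1 ≤φ 1
  1≤φ = from (diff-≤√ X Y (1 * 1 * D))
    (inj₂ (subst (X * X + Y * Y ≤_) (sym (gap k)) (ℕP.m≤m+n (X * X + Y * Y) 4)))
    where
    X = 2 * 1 + k * 1
    Y = 2 * 1
    gap : ∀ k → 1 * 1 * (k * k + 4) + 2 * ((2 * 1 + k * 1) * (2 * 1))
              ≡ (2 * 1 + k * 1) * (2 * 1 + k * 1) + 2 * 1 * (2 * 1) + 4
    gap = ℕR.solve-∀

  φ<2 : ¬ 2 ≤φ 1
  φ<2 h = [ small , large ]′ (to (diff-≤√ X Y c) h)
    where
    X = 2 * 2 + k * 1
    Y = 2 * 1
    c = 1 * 1 * D
    small : ¬ X ≤ Y
    small = ℕP.<⇒≱ (s≤s (s≤s (s≤s z≤n)))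
    gap : ∀ k → (2 * 2 + k * 1) * (2 * 2 + k * 1) + 2 * 1 * (2 * 1)
              ≡ (1 * 1 * (k * k + 4) + 2 * ((2 * 2 + k * 1) * (2 * 1))) + 4 * k
    gap = ℕR.solve-∀
    large : ¬ X * X + Y * Y ≤ c + 2 * (X * Y)
    large sq = ℕP.<⇒≱ (ℕP.m<m+n _ (ℕP.<-≤-trans (s≤s z≤n) (ℕP.*-monoʳ-≤ 4 k≥1)))
                      (subst (_≤ c + 2 * (X * Y)) (gap k) sq)

  φ-lo φ-hi ψ-lo ψ-hi : ℕ → ℕ → ℕ
  φ-lo N i = k * N * i + N * N
  φ-hi N i = k * i * i + 2 * N * i
  ψ-lo N i = k * i * i + N * N
  ψ-hi N i = 2 * N * i + k * N * i

  ≤φ⇔ : ∀ N i → N ≤φ i ⇔ φ-lo N i ≤ φ-hi N i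
  ≤φ⇔ N i = mk⇔
    (λ h → [ nonPos , (λ sq → to (balance (expand k N i)) sq) ]′ (to (diff-≤√ X Y c) h))
    (λ le → from (diff-≤√ X Y c) (inj₂ (from (balance (expand k N i)) le)))
    where
    X = 2 * N + k * i
    Y = 2 * i
    c = i * i * D
    expand : ∀ k N i → (2 * N + k * i) * (2 * N + k * i) + 2 * i * (2 * i) + 4 * (k * i * i + 2 * N * i)
                     ≡ (i * i * (k * k + 4) + 2 * ((2 * N + k * i) * (2 * i))) + 4 * (k * N * i + N * N)
    expand = ℕR.solve-∀
    -- when 2N + ki ≤ 2i the comparison holds for the crude reason N ≤ i
    nonPos : X ≤ Y → φ-lo N i ≤ φ-hi N i
    nonPos X≤Y = begin
      φ-lo N i                ≤⟨ ℕP.m≤m+n (φ-lo N i) (N * N) ⟩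
      φ-lo N i + N * N        ≡⟨ factor k N i ⟩
      N * X                   ≤⟨ ℕP.*-monoʳ-≤ N X≤Y ⟩
      N * Y                   ≡⟨ rearrange N i ⟩
      2 * N * i               ≤⟨ ℕP.m≤n+m (2 * N * i) (k * i * i) ⟩
      φ-hi N i                ∎
      where
      open ℕP.≤-Reasoning
      factor : ∀ k N i → k * N * i + N * N + N * N ≡ N * (2 * N + k * i)
      factor = ℕR.solve-∀
      rearrange : ∀ N i → N * (2 * i) ≡ 2 * N * i
      rearrange = ℕR.solve-∀

  ≤ψ⇔ : ∀ N i → N ≤ψ i ⇔ (2 * N ≤ (2 + k) * i ⊎ ψ-lo N i ≤ ψ-hi N i)
  ≤ψ⇔ N i = mk⇔
    (λ h → Sum.map₂ (to (balance (expand k N i))) (to (diff-≤√ X Y c) h))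
    (λ h → from (diff-≤√ X Y c) (Sum.map₂ (from (balance (expand k N i))) h))
    where
    X = 2 * N
    Y = (2 + k) * i
    c = i * i * D
    expand : ∀ k N i → (2 * N) * (2 * N) + ((2 + k) * i) * ((2 + k) * i) + 4 * (2 * N * i + k * N * i)
                     ≡ (i * i * (k * k + 4) + 2 * ((2 * N) * ((2 + k) * i))) + 4 * (k * i * i + N * N)
    expand = ℕR.solve-∀

  -- Since φ, ψ > 1, every N ≤ i satisfies  N ≤ iφ  and  N ≤ iψ.
  ≤φ-large : ∀ {N i} → N ≤ i → N ≤φ i
  ≤φ-large {N} {i} N≤i = from (≤φ⇔ N i) (ℕP.+-mono-≤ (ℕP.*-monoˡ-≤ i (ℕP.*-monoʳ-≤ k N≤i)) NN≤2Ni)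
    where
    twice : ∀ N i → N * i + N * i ≡ 2 * N * i
    twice = ℕR.solve-∀
    NN≤2Ni : N * N ≤ 2 * N * i
    NN≤2Ni = ℕP.≤-trans (ℕP.*-monoʳ-≤ N N≤i) (subst (N * i ≤_) (twice N i) (ℕP.m≤m+n _ _))

  ≤ψ-large : ∀ {N i} → N ≤ i → N ≤ψ i
  ≤ψ-large {N} {i} N≤i = from (≤ψ⇔ N i) (inj₁ (ℕP.≤-trans (ℕP.*-monoʳ-≤ 2 N≤i) (ℕP.*-monoˡ-≤ i (ℕP.m≤m+n 2 k))))

  ≰ψ-zero : ∀ {N} → 1 ≤ N → ¬ N ≤ψ 0
  ≰ψ-zero {N} 1≤N h = [ (λ 2N≤0 → ℕP.<⇒≱ 0<2N (subst (2 * N ≤_) (ℕP.*-zeroʳ (2 + k)) 2N≤0))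
                      , (λ le → ℕP.<⇒≱ 0<NN (subst₂ _≤_ (at-zero k N) (at-zero' k N) le)) ]′
                      (to (≤ψ⇔ N 0) h)
    where
    0<2N : 0 < 2 * N
    0<2N = ℕP.≤-trans 1≤N (ℕP.m≤n*m N 2)
    0<NN : 0 < N * N
    0<NN = ℕP.*-mono-≤ 1≤N 1≤N
    at-zero : ∀ k N → k * 0 * 0 + N * N ≡ N * N
    at-zero = ℕR.solve-∀
    at-zero' : ∀ k N → 2 * N * 0 + k * N * 0 ≡ 0
    at-zero' = ℕR.solve-∀

  -- φ − 1 = (√D − k)/2 is irrational: u² + kuv = v² has no solution with
  -- v ≥ 1.  By descent: a solution forces 0 < u < v and ku ≤ v, and then
  -- (u, v − ku) is a smaller solution.
  no-rational-root : ∀ v → Acc _<_ v → ∀ u → 1 ≤ v → u * u + k * u * v ≢ v * v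
  no-rational-root v _ zero 1≤v eq =
    ℕP.<⇒≢ (ℕP.*-mono-≤ 1≤v 1≤v) (trans (sym (vanish k v)) eq)
    where
    vanish : ∀ k v → 0 * 0 + k * 0 * v ≡ 0
    vanish = ℕR.solve-∀
  no-rational-root v@(suc _) (acc smaller) u@(suc _) 1≤v eq =
    no-rational-root u (smaller u<v) w (s≤s z≤n) w-eq
    where
    u<v : u < v
    u<v = ℕP.≰⇒> λ v≤u → ℕP.<⇒≢
      (ℕP.≤-<-trans (ℕP.*-mono-≤ v≤u v≤u)
                    (ℕP.m<m+n (u * u) (ℕP.*-mono-≤ (ℕP.*-mono-≤ k≥1 (s≤s z≤n)) 1≤v)))
      (sym eq)
    ku≤v : k * u ≤ v
    ku≤v = ℕP.*-cancelʳ-≤ (k * u) v v (subst (k * u * v ≤_) eq (ℕP.m≤n+m _ (u * u)))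
    w = v ∸ k * u
    v≡ : w + k * u ≡ v
    v≡ = ℕP.m∸n+n≡m ku≤v
    expand : ∀ k u w → (w + k * u) * (w + k * u) + u * u
                     ≡ (u * u + k * u * (w + k * u)) + (w * w + k * w * u)
    expand = ℕR.solve-∀
    w-eq : w * w + k * w * u ≡ u * u
    w-eq = sym (ℕP.+-cancelˡ-≡ (v * v) _ _ (begin
      v * v + u * u                                 ≡⟨ subst (λ z → z * z + u * u ≡ (u * u + k * u * z) + (w * w + k * w * u)) v≡ (expand k u w) ⟩
      (u * u + k * u * v) + (w * w + k * w * u)     ≡⟨ cong (_+ (w * w + k * w * u)) eq ⟩
      v * v + (w * w + k * w * u)                   ∎))
      where open ≡-Reasoning

  φ-irrational : ∀ {N x} → 1 ≤ N → x ≤ N → φ-lo N x ≢ φ-hi N x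
  φ-irrational {N} {zero} 1≤N _ eq =
    ℕP.<⇒≢ (ℕP.*-mono-≤ 1≤N 1≤N) (sym (trans (sym (at-zero₁ k N)) (trans eq (at-zero₂ k N))))
    where
    at-zero₁ : ∀ k N → k * N * 0 + N * N ≡ N * N
    at-zero₁ = ℕR.solve-∀
    at-zero₂ : ∀ k N → k * 0 * 0 + 2 * N * 0 ≡ 0
    at-zero₂ = ℕR.solve-∀
  φ-irrational {N} {x@(suc _)} 1≤N x≤N eq =
    no-rational-root x (<-wellFounded x) u (s≤s z≤n) u-eq
    where
    u = N ∸ x
    expand : ∀ k u x → (k * x * x + 2 * (u + x) * x) + (u * u + k * u * x)
                     ≡ (k * (u + x) * x + (u + x) * (u + x)) + x * x
    expand = ℕR.solve-∀
    u-eq : u * u + k * u * x ≡ x * x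
    u-eq = ℕP.+-cancelˡ-≡ (φ-hi N x) _ _ (begin
      φ-hi N x + (u * u + k * u * x)   ≡⟨ subst (λ M → φ-hi M x + (u * u + k * u * x) ≡ φ-lo M x + x * x) (ℕP.m∸n+n≡m x≤N) (expand k u x) ⟩
      φ-lo N x + x * x                 ≡⟨ cong (_+ x * x) eq ⟩
      φ-hi N x + x * x                 ∎)
      where open ≡-Reasoning

  -- xφ ≤ N as soon as (2 + k)x ≤ kN, because φ ≤ (2 + k)/k.
  φ-below : ∀ N x → (2 + k) * x ≤ k * N → φ-hi N x ≤ φ-lo N x
  φ-below N x h = ℕP.*-cancelˡ-≤ (2 + k) (begin
    (2 + k) * φ-hi N x                                     ≡⟨ split₁ k N x ⟩
    (k * x) * ((2 + k) * x) + 2 * k * N * x + N * (4 * x)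
      ≤⟨ ℕP.+-mono-≤ (ℕP.+-monoˡ-≤ (2 * k * N * x) (ℕP.*-monoʳ-≤ (k * x) h)) (ℕP.*-monoʳ-≤ N 4x≤) ⟩
    (k * x) * (k * N) + 2 * k * N * x + N * ((2 + k) * N)  ≡⟨ split₂ k N x ⟨
    (2 + k) * φ-lo N x                                     ∎)
    where
    open ℕP.≤-Reasoning
    split₁ : ∀ k N x → (2 + k) * (k * x * x + 2 * N * x)
                     ≡ (k * x) * ((2 + k) * x) + 2 * k * N * x + N * (4 * x)
    split₁ = ℕR.solve-∀
    split₂ : ∀ k N x → (2 + k) * (k * N * x + N * N)
                     ≡ (k * x) * (k * N) + 2 * k * N * x + N * ((2 + k) * N)
    split₂ = ℕR.solve-∀
    scale : ∀ k x → (2 + k) * (4 * x) ≡ 4 * ((2 + k) * x)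
    scale = ℕR.solve-∀
    square : ∀ k N → 4 * (k * N) + (4 + k * k) * N ≡ (2 + k) * ((2 + k) * N)
    square = ℕR.solve-∀
    4x≤ : 4 * x ≤ (2 + k) * N
    4x≤ = ℕP.*-cancelˡ-≤ (2 + k) (begin
      (2 + k) * (4 * x)              ≡⟨ scale k x ⟩
      4 * ((2 + k) * x)              ≤⟨ ℕP.*-monoʳ-≤ 4 h ⟩
      4 * (k * N)                    ≤⟨ ℕP.m≤m+n _ _ ⟩
      4 * (k * N) + (4 + k * k) * N  ≡⟨ square k N ⟩
      (2 + k) * ((2 + k) * N)        ∎)

  -- The polynomial shadow of 1/φ + 1/ψ = 1.
  reflection-identity : ∀ x i → φ-hi (x + i) x + ψ-hi (x + i) i ≡ φ-lo (x + i) x + ψ-lo (x + i) i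
  reflection-identity x i = expand k x i
    where
    expand : ∀ k x i → (k * x * x + 2 * (x + i) * x) + (2 * (x + i) * i + k * (x + i) * i)
                     ≡ (k * (x + i) * x + (x + i) * (x + i)) + (k * i * i + (x + i) * (x + i))
    expand = ℕR.solve-∀

  -- For 0 < N and i ≤ N:  N > iψ  ⟺  N ≤ (N − i)φ.  This pairs the indices
  -- counted by the two Beatty sequences.
  reflect : ∀ {N i} → 1 ≤ N → i ≤ N → (¬ N ≤ψ i) ⇔ N ≤φ (N ∸ i)
  reflect {N} {i} 1≤N i≤N = mk⇔ ⇒ ⇐
    where
    x = N ∸ i
    x+i≡N : x + i ≡ N
    x+i≡N = ℕP.m∸n+n≡m i≤N
    identity : φ-hi N x + ψ-hi N i ≡ φ-lo N x + ψ-lo N i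
    identity = subst (λ M → φ-hi M x + ψ-hi M i ≡ φ-lo M x + ψ-lo M i) x+i≡N (reflection-identity x i)
    identity′ : ψ-lo N i + φ-lo N x ≡ ψ-hi N i + φ-hi N x
    identity′ = trans (ℕP.+-comm (ψ-lo N i) _) (trans (sym identity) (ℕP.+-comm (φ-hi N x) _))
    ⇒ : ¬ N ≤ψ i → N ≤φ x
    ⇒ N>iψ = from (≤φ⇔ N x) (ℕP.<⇒≤ (cross-< identity ψ-hi<ψ-lo))
      where
      ψ-hi<ψ-lo : ψ-hi N i < ψ-lo N i
      ψ-hi<ψ-lo = ℕP.≰⇒> (λ le → N>iψ (from (≤ψ⇔ N i) (inj₂ le)))
    ⇐ : N ≤φ x → ¬ N ≤ψ i
    ⇐ N≤xφ N≤iψ = [ ℕP.<⇒≱ 2N>[2+k]i , ℕP.<⇒≱ (cross-< identity′ φ-lo<φ-hi) ]′ (to (≤ψ⇔ N i) N≤iψ)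
      where
      φ-lo<φ-hi : φ-lo N x < φ-hi N x
      φ-lo<φ-hi = ℕP.≤∧≢⇒< (to (≤φ⇔ N x) N≤xφ) (φ-irrational 1≤N (ℕP.m∸n≤m N i))
      kN<[2+k]x : k * N < (2 + k) * x
      kN<[2+k]x = ℕP.≰⇒> (λ le → ℕP.<⇒≱ φ-lo<φ-hi (φ-below N x le))
      regroup : ∀ k N → (2 + k) * N ≡ 2 * N + k * N
      regroup = ℕR.solve-∀
      total : (2 + k) * i + (2 + k) * x ≡ 2 * N + k * N
      total = trans (sym (ℕP.*-distribˡ-+ (2 + k) i x))
                    (trans (cong ((2 + k) *_) (trans (ℕP.+-comm i x) x+i≡N)) (regroup k N))
      2N>[2+k]i : (2 + k) * i < 2 * N
      2N>[2+k]i = ℕP.+-cancelʳ-< (k * N) _ _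
        (subst ((2 + k) * i + k * N <_) total (ℕP.+-monoʳ-< ((2 + k) * i) kN<[2+k]x))

module Sequences (m p : ℕ) (m≥1 : 1 ≤ m) (p≥1 : 1 ≤ p) (a b : ℕ → ℕ)
  (a-floor : ∀ n → IsFloor (mulDiv n (φ (m * p)) p) (a n))
  (b-floor : ∀ n → IsFloor (mulDiv n (addℕ (φ (m * p)) (m * p)) p) (b n)) where

  k : ℕ
  k = m * p

  open Quadratic k (ℕP.*-mono-≤ m≥1 p≥1)

  x y : ℕ → Surd
  x n = mulDiv n (φ k) p
  y n = mulDiv n (addℕ (φ k) k) p

  ≤ˢ-x : ∀ q n → ((+ q) ≤ˢ x n) ≡ (p * q ≤φ n)
  ≤ˢ-x q n = cong₂ _≤√_ T-eq (cong (λ z → z * z * D) (ℕP.*-identityʳ n))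
    where
    open ≡-Reasoning
    rearrange : ∀ q p n k → q ℤ.* (p ℤ.* + 2) ℤ.- n ℤ.* (+ 2 ℤ.- k)
                          ≡ (+ 2 ℤ.* (p ℤ.* q) ℤ.+ k ℤ.* n) ℤ.- + 2 ℤ.* n
    rearrange = ℤR.solve-∀
    T-eq : + q ℤ.* + (p * 2) ℤ.- + n ℤ.* (+ 2 ℤ.- + k) ≡ Tφ (p * q) n
    T-eq = begin
      + q ℤ.* + (p * 2) ℤ.- + n ℤ.* (+ 2 ℤ.- + k)
        ≡⟨ cong (λ z → + q ℤ.* z ℤ.- + n ℤ.* (+ 2 ℤ.- + k)) (ℤP.pos-* p 2) ⟩
      + q ℤ.* (+ p ℤ.* + 2) ℤ.- + n ℤ.* (+ 2 ℤ.- + k)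
        ≡⟨ rearrange (+ q) (+ p) (+ n) (+ k) ⟩
      (+ 2 ℤ.* (+ p ℤ.* + q) ℤ.+ + k ℤ.* + n) ℤ.- + 2 ℤ.* + n
        ≡⟨ cong₂ ℤ._-_ (trans (ℤP.pos-+ (2 * (p * q)) (k * n))
                         (cong₂ ℤ._+_ (trans (ℤP.pos-* 2 (p * q)) (cong (+ 2 ℤ.*_) (ℤP.pos-* p q)))
                                      (ℤP.pos-* k n)))
                       (ℤP.pos-* 2 n) ⟨
      Tφ (p * q) n ∎

  ≤ˢ-y : ∀ q n → ((+ q) ≤ˢ y n) ≡ (p * q ≤ψ n)
  ≤ˢ-y q n = cong₂ _≤√_ T-eq (cong (λ z → z * z * D) (ℕP.*-identityʳ n))
    where
    open ≡-Reasoning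
    rearrange : ∀ q p n k → q ℤ.* (p ℤ.* + 2) ℤ.- n ℤ.* ((+ 2 ℤ.- k) ℤ.+ k ℤ.* + 2)
                          ≡ + 2 ℤ.* (p ℤ.* q) ℤ.- (+ 2 ℤ.+ k) ℤ.* n
    rearrange = ℤR.solve-∀
    T-eq : + q ℤ.* + (p * 2) ℤ.- + n ℤ.* ((+ 2 ℤ.- + k) ℤ.+ + (k * 2))
         ≡ + (2 * (p * q)) ℤ.- + ((2 + k) * n)
    T-eq = begin
      + q ℤ.* + (p * 2) ℤ.- + n ℤ.* ((+ 2 ℤ.- + k) ℤ.+ + (k * 2))
        ≡⟨ cong₂ (λ u v → + q ℤ.* u ℤ.- + n ℤ.* ((+ 2 ℤ.- + k) ℤ.+ v)) (ℤP.pos-* p 2) (ℤP.pos-* k 2) ⟩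
      + q ℤ.* (+ p ℤ.* + 2) ℤ.- + n ℤ.* ((+ 2 ℤ.- + k) ℤ.+ + k ℤ.* + 2)
        ≡⟨ rearrange (+ q) (+ p) (+ n) (+ k) ⟩
      + 2 ℤ.* (+ p ℤ.* + q) ℤ.- (+ 2 ℤ.+ + k) ℤ.* + n
        ≡⟨ cong₂ ℤ._-_ (trans (ℤP.pos-* 2 (p * q)) (cong (+ 2 ℤ.*_) (ℤP.pos-* p q)))
                       (trans (ℤP.pos-* (2 + k) n) (cong (ℤ._* + n) (ℤP.pos-+ 2 k))) ⟨
      + (2 * (p * q)) ℤ.- + ((2 + k) * n) ∎

  -- Since nψ/p = nφ/p + mn, the floor of y n is the floor of x n plus mn.
  IsFloor-shift : ∀ q n → IsFloor (y n) (q + m * n) ≡ IsFloor (x n) q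
  IsFloor-shift q n = cong₂ (λ A B → A × ¬ B) (shift q) (shift (suc q))
    where
    distrib : ∀ p q m n → p * (q + m * n) ≡ p * q + m * p * n
    distrib = ℕR.solve-∀
    shift : ∀ q → ((+ (q + m * n)) ≤ˢ y n) ≡ ((+ q) ≤ˢ x n)
    shift q = trans (≤ˢ-y (q + m * n) n)
      (trans (cong (_≤ψ n) (distrib p q m n)) (trans (≤ψ-shift (p * q) n) (sym (≤ˢ-x q n))))

  b≡a+mn : ∀ n → b n ≡ a n + m * n
  b≡a+mn n = floor-unique (y n) (b-floor n) (subst (λ P → P) (sym (IsFloor-shift (a n) n)) (a-floor n))

  a-below : ∀ n → p * a n ≤φ n
  a-below n = subst (λ P → P) (≤ˢ-x (a n) n) (proj₁ (a-floor n))

  a-above : ∀ n → ¬ p * suc (a n) ≤φ n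
  a-above n = subst (λ P → ¬ P) (≤ˢ-x (suc (a n)) n) (proj₂ (a-floor n))

  -- From 1 ≤ φ < 2:  pa_n + 1 < p(a_{n+1} + 1)  and  pa_{n+1} < p(a_n + 1) + 2.
  a-step : ∀ n → 1 + p * a n < p * suc (a (suc n)) × p * a (suc n) < 2 + p * suc (a n)
  a-step n =
      ℕP.≰⇒> (λ le → a-above (suc n) (≤φ-downward {i = suc n} le
                                        (≤φ-+ {1} {p * a n} {1} {n} 1≤φ (a-below n))))
    , ℕP.≰⇒> (λ le → ≰φ-+ {2} {p * suc (a n)} {1} {n} φ<2 (a-above n)
                                        (≤φ-downward {i = suc n} le (a-below (suc n))))

  b-increment : ∀ n d → a (suc n) ≡ a n + d → b (suc n) ≡ b n + (m + d)
  b-increment n d a-inc = begin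
    b (suc n)              ≡⟨ b≡a+mn (suc n) ⟩
    a (suc n) + m * suc n  ≡⟨ cong (_+ m * suc n) a-inc ⟩
    a n + d + m * suc n    ≡⟨ regroup (a n) d m n ⟩
    a n + m * n + (m + d)  ≡⟨ cong (_+ (m + d)) (b≡a+mn n) ⟨
    b n + (m + d)          ∎
    where
    open ≡-Reasoning
    regroup : ∀ A d m n → A + d + m * suc n ≡ A + m * n + (m + d)
    regroup = ℕR.solve-∀

  steps-p≡1 : p ≡ 1 → ∀ n →
    (a (suc n) ≡ a n + 1 × b (suc n) ≡ b n + (m + 1))
    ⊎ (a (suc n) ≡ a n + 2 × b (suc n) ≡ b n + (m + 2))
  steps-p≡1 p≡1 n = Sum.map (λ e → e , b-increment n 1 e) (λ e → e , b-increment n 2 e)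
    (increment-p≡1 (subst (λ q → 1 + q * a n < q * suc (a (suc n))) p≡1 (proj₁ (a-step n)))
                   (subst (λ q → q * a (suc n) < 2 + q * suc (a n)) p≡1 (proj₂ (a-step n))))

  steps-p>1 : p > 1 → ∀ n →
    (a (suc n) ≡ a n × b (suc n) ≡ b n + m)
    ⊎ (a (suc n) ≡ a n + 1 × b (suc n) ≡ b n + (m + 1))
  steps-p>1 p>1 n = Sum.map (λ e → e , constant-a e) (λ e → e , b-increment n 1 e)
    (increment-p>1 p>1 (proj₁ (a-step n)) (proj₂ (a-step n)))
    where
    constant-a : a (suc n) ≡ a n → b (suc n) ≡ b n + m
    constant-a e = trans (b-increment n 0 (trans e (sym (ℕP.+-identityʳ (a n)))))
                         (cong (_+_ (b n)) (ℕP.+-identityʳ m))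

  a<⇔ : ∀ i J → a i < J ⇔ (¬ p * J ≤φ i)
  a<⇔ i J = subst (λ P → a i < J ⇔ (¬ P)) (≤ˢ-x J i) (floor-<⇔ (x i) (a-floor i))

  b<⇔ : ∀ i J → b i < J ⇔ (¬ p * J ≤ψ i)
  b<⇔ i J = subst (λ P → b i < J ⇔ (¬ P)) (≤ˢ-y J i) (floor-<⇔ (y i) (b-floor i))

  a-small : ∀ {i J} → a i < J → i < p * J
  a-small {i} {J} aᵢ<J = ℕP.≰⇒> (λ pJ≤i → to (a<⇔ i J) aᵢ<J (≤φ-large pJ≤i))

  b-small : ∀ {i J} → b i < J → i < p * J
  b-small {i} {J} bᵢ<J = ℕP.≰⇒> (λ pJ≤i → to (b<⇔ i J) bᵢ<J (≤ψ-large pJ≤i))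

  b-zero : ∀ {J} → 1 ≤ J → b 0 < J
  b-zero {J} 1≤J = from (b<⇔ 0 J) (≰ψ-zero (ℕP.*-mono-≤ p≥1 1≤J))

  -- Beatty's count: for J ≥ 1 and N = pJ,
  --   #{i ≤ N | a_i < J} + #{i ≤ N | b_i < J} = N + 1,
  -- because b_i < J exactly when a_{N−i} ≥ J.
  beatty-count : ∀ J → 1 ≤ J →
    count (λ i → a i <? J) (suc (p * J)) + count (λ i → b i <? J) (suc (p * J)) ≡ suc (p * J)
  beatty-count J 1≤J = begin
    count (λ i → a i <? J) (suc N) + count (λ i → b i <? J) (suc N)
      ≡⟨ cong₂ _+_ (count-cong (λ i → a i <? J) ¬φ? (suc N) (λ i _ → a<⇔ i J))
                   (count-cong (λ i → b i <? J) (λ i → N ≤φ? N ∸ i) (suc N)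
                     (λ i i≤N → reflect 1≤N (ℕP.≤-pred i≤N) ⇔-∘ b<⇔ i J)) ⟩
    count ¬φ? (suc N) + count (λ i → N ≤φ? N ∸ i) (suc N)
      ≡⟨ cong (_+_ (count ¬φ? (suc N))) (count-reflect (N ≤φ?_) N) ⟩
    count ¬φ? (suc N) + count (N ≤φ?_) (suc N)
      ≡⟨ ℕP.+-comm (count ¬φ? (suc N)) _ ⟩
    count (N ≤φ?_) (suc N) + count ¬φ? (suc N)
      ≡⟨ count-complement (N ≤φ?_) (suc N) ⟩
    suc N ∎
    where
    open ≡-Reasoning
    N = p * J
    1≤N : 1 ≤ N
    1≤N = ℕP.*-mono-≤ p≥1 1≤J
    ¬φ? = λ i → ¬? (N ≤φ? i)

  counts-below : ∀ J R → p * J < R →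
    count (λ i → a i <? J) R + count (λ i → b (suc i) <? J) R ≡ p * J
  counts-below zero R _ =
    trans (cong₂ _+_ (count-stable (λ i → a i <? 0) {M = R} z≤n (λ i ()))
                     (count-stable (λ i → b (suc i) <? 0) {M = R} z≤n (λ i ())))
          (sym (ℕP.*-zeroʳ p))
  counts-below J@(suc _) R pJ<R = ℕP.suc-injective (begin
    suc (A + B)                                       ≡⟨ ℕP.+-suc A B ⟨
    A + suc B                                         ≡⟨ cong (_+_ A) prepend-b₀ ⟩
    A + count (λ i → b i <? J) (suc R)
      ≡⟨ cong₂ _+_ (count-stable (λ i → a i <? J) pJ<R (λ i lt → ℕP.m<n⇒m<1+n (a-small lt)))
                   (count-stable (λ i → b i <? J) (ℕP.m≤n⇒m≤1+n pJ<R) (λ i lt → ℕP.m<n⇒m<1+n (b-small lt))) ⟩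
    count (λ i → a i <? J) (suc (p * J)) + count (λ i → b i <? J) (suc (p * J))
      ≡⟨ beatty-count J (s≤s z≤n) ⟩
    suc (p * J)                                       ∎)
    where
    open ≡-Reasoning
    A = count (λ i → a i <? J) R
    B = count (λ i → b (suc i) <? J) R
    prepend-b₀ : suc B ≡ count (λ i → b i <? J) (suc R)
    prepend-b₀ = sym (trans (count-suc (λ i → b i <? J) R)
                            (cong (_+ B) (ind-cong (b 0 <? J) (yes (b-zero (s≤s z≤n))) (⇔-id _))))

  -- (i): the count of j among the a_i plus its count among the b_{i+1} is
  -- the growth p of the counting functions from j to j + 1.
  complementary : Complementary p a (λ i → b (suc i))
  complementary j =
      count (λ i → a i ≟ j) R , count (λ i → b (suc i) ≟ j) R
    , count-HasCount a j R a-bound , count-HasCount (λ i → b (suc i)) j R b-bound , sum≡p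
    where
    open ≡-Reasoning
    R = suc (p * suc j)
    a-bound : ∀ i → a i ≡ j → i < R
    a-bound i aᵢ≡j = ℕP.m<n⇒m<1+n (a-small (ℕP.≤-reflexive (cong suc aᵢ≡j)))
    b-bound : ∀ i → b (suc i) ≡ j → i < R
    b-bound i bᵢ₊₁≡j = ℕP.<-trans (ℕP.n<1+n i) (ℕP.m<n⇒m<1+n (b-small (ℕP.≤-reflexive (cong suc bᵢ₊₁≡j))))
    Aj = count (λ i → a i <? j) R
    Bj = count (λ i → b (suc i) <? j) R
    Ca = count (λ i → a i ≟ j) R
    Cb = count (λ i → b (suc i) ≟ j) R
    sum≡p : Ca + Cb ≡ p
    sum≡p = ℕP.+-cancelˡ-≡ (p * j) (Ca + Cb) p (begin
      p * j + (Ca + Cb)        ≡⟨ cong (_+ (Ca + Cb)) (counts-below j R (s≤s (ℕP.*-monoʳ-≤ p (ℕP.n≤1+n j)))) ⟨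
      (Aj + Bj) + (Ca + Cb)    ≡⟨ interchange Aj Bj Ca Cb ⟩
      (Aj + Ca) + (Bj + Cb)    ≡⟨ cong₂ _+_ (count-<-suc a j R) (count-<-suc (λ i → b (suc i)) j R) ⟨
      count (λ i → a i <? suc j) R + count (λ i → b (suc i) <? suc j) R
                               ≡⟨ counts-below (suc j) R ℕP.≤-refl ⟩
      p * suc j                ≡⟨ ℕP.*-suc p j ⟩
      p + p * j                ≡⟨ ℕP.+-comm p (p * j) ⟩
      p * j + p                ∎)

lemma3p3 : (m p : ℕ) → 1 ≤ m → 1 ≤ p → (a b : ℕ → ℕ) →
    (∀ n → IsFloor (mulDiv n (φ (m * p)) p) (a n)) →
    (∀ n → IsFloor (mulDiv n (addℕ (φ (m * p)) (m * p)) p) (b n)) →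
    Complementary p a (λ i → b (suc i))
    × (∀ n → b n ≡ a n + m * n)
    × (p ≡ 1 → ∀ n →
        (a (suc n) ≡ a n + 1 × b (suc n) ≡ b n + (m + 1))
        ⊎ (a (suc n) ≡ a n + 2 × b (suc n) ≡ b n + (m + 2)))
    × (p > 1 → ∀ n →
        (a (suc n) ≡ a n × b (suc n) ≡ b n + m)
        ⊎ (a (suc n) ≡ a n + 1 × b (suc n) ≡ b n + (m + 1)))
lemma3p3 m p m≥1 p≥1 a b a-floor b-floor = complementary , b≡a+mn , steps-p≡1 , steps-p>1
  where open Sequences m p m≥1 p≥1 a b a-floor b-floor
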